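{- Let $G$ be a connected graph of order $n$ with $rx_4(G)=3$. Then $n\le 9$.
   Context: For a connected graph $G$, an edge-coloring $c:E(G)\to\{1,\dots,q\}$ (adjacent edges may get the same color) is a $4$-rainbow coloring if for every set $S$ of $4$ vertices there is a tree in $G$ containing $S$ whose edges have pairwise distinct colors. $rx_4(G)$ is the minimum $q$ for which such a coloring exists. -}

module Defs where

open import Data.Nat using (ℕ; suc; _<_)
open import Data.Bool using (Bool; true; false)
open import Data.Fin using (Fin)
open import Data.Fin.Subset using (Subset; _∈_; ∣_∣)
open import Data.Product using (Σ; _×_; _,_; proj₁; proj₂; swap)
open import Data.Sum using (_⊎_)
open import Data.List using (List; length; map)
open import Data.List.Membership.Propositional using () renaming (_∈_ to _∈ₗ_)
open import Data.List.Relation.Unary.All using (All)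
open import Data.List.Relation.Unary.AllPairs using (AllPairs)
open import Data.List.Relation.Unary.Unique.Propositional using (Unique)
open import Relation.Binary.Construct.Closure.ReflexiveTransitive using (Star)
open import Relation.Binary.PropositionalEquality using (_≡_)
open import Relation.Nullary using (¬_)

record Graph (n : ℕ) : Set where
  field
    adj    : Fin n → Fin n → Bool
    sym    : ∀ u v → adj u v ≡ adj v u
    irrefl : ∀ u → adj u u ≡ false

Adj : ∀ {n} → Graph n → Fin n → Fin n → Set
Adj G u v = Graph.adj G u v ≡ true

Connected : ∀ {n} → Graph n → Set
Connected {n} G = ∀ (u v : Fin n) → Star (Adj G) u v

-- An edge-coloring with colors Fin q (= {1,…,q}); the value on an edge uv
-- must not depend on orientation; values on non-edges are irrelevant.
EdgeColoring : ∀ {n} → Graph n → ℕ → Set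
EdgeColoring {n} G q =
  Σ (Fin n → Fin n → Fin q) λ c → ∀ u v → Adj G u v → c u v ≡ c v u

Edge : ℕ → Set
Edge n = Fin n × Fin n

SameEdge : ∀ {n} → Edge n → Edge n → Set
SameEdge e f = (e ≡ f) ⊎ (swap e ≡ f)

EdgeAdj : ∀ {n} → List (Edge n) → Fin n → Fin n → Set
EdgeAdj es u v = ((u , v) ∈ₗ es) ⊎ ((v , u) ∈ₗ es)

-- A tree in G containing the vertex set S: a subgraph (verts, edges) of G
-- that is connected and has |E| = |V| - 1 (i.e. is a tree), with S ⊆ V.
record TreeIn {n} (G : Graph n) (S : Subset n) : Set where
  field
    verts       : List (Fin n)
    edges       : List (Edge n)
    vertsUnique : Unique verts
    edgesDistinct : AllPairs (λ e f → ¬ SameEdge e f) edges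
    edgesInG    : All (λ e → Adj G (proj₁ e) (proj₂ e)) edges
    endpoints   : All (λ e → (proj₁ e ∈ₗ verts) × (proj₂ e ∈ₗ verts)) edges
    connected   : ∀ {u v} → u ∈ₗ verts → v ∈ₗ verts → Star (EdgeAdj edges) u v
    size        : suc (length edges) ≡ length verts
    containsS   : ∀ v → v ∈ S → v ∈ₗ verts

Rainbow : ∀ {n q} {G : Graph n} {S : Subset n} → EdgeColoring G q → TreeIn G S → Set
Rainbow (c , _) T = Unique (map (λ e → c (proj₁ e) (proj₂ e)) (TreeIn.edges T))

Is4Rainbow : ∀ {n q} (G : Graph n) → EdgeColoring G q → Set
Is4Rainbow {n} G c =
  ∀ (S : Subset n) → ∣ S ∣ ≡ 4 → Σ (TreeIn G S) λ T → Rainbow c T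

Has4RainbowColoring : ∀ {n} → Graph n → ℕ → Set
Has4RainbowColoring G q = Σ (EdgeColoring G q) λ c → Is4Rainbow G c

rx4≡ : ∀ {n} → Graph n → ℕ → Set
rx4≡ G k = Has4RainbowColoring G k × (∀ q → q < k → ¬ Has4RainbowColoring G q)

module Submission where

-- Restrict a 4-rainbow colouring with colours 0, 1, 2 to ten vertices.  A
-- rainbow tree through four given vertices has at most three edges, so its
-- vertices are exactly the four given ones and it uses every colour: within
-- each colour class any four vertices span an edge, and, as the two other
-- classes span one edge each among the six pairs, at most four edges.  Such a
-- colour class has no vertex with seven non-neighbours, so every vertex has at
-- least three neighbours in each class and, the classes sharing the nine other
-- vertices, each class is 3-regular.  But a 3-regular graph on ten vertices in
-- which any four vertices span one to four edges does not exist: without a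
-- triangle, six non-neighbours of a vertex contradict R(3,3) = 6, and with a
-- triangle an exhaustive search rules it out.

open import Defs
open import Data.Bool using (Bool; true; false; _∧_; _∨_; not; if_then_else_; T)
open import Data.Bool.ListAction using (any)
open import Data.Bool.Properties using (T-∧; T-∨; T-≡)
open import Data.Empty using (⊥; ⊥-elim)
open import Data.Fin using (Fin; zero; suc; toℕ; #_; _≟_; inject≤; punchIn; punchOut)
open import Data.Fin.Properties
  using (toℕ-injective; inject≤-injective; injective⇒≤; punchIn-injective; punchInᵢ≢i; punchIn-punchOut; any?)
open import Data.Fin.Subset
  using (Subset; ⁅_⁆; _∪_; inside; outside; ∣_∣) renaming (⊥ to ∅; _∈_ to _∈ₛ_; _∉_ to _∉ₛ_)
open import Data.Fin.Subset.Properties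
  using (x∈p∪q⁻; x∈p∪q⁺; x∈⁅x⁆; x∈⁅y⁆⇒x≡y; ∪-identityˡ; ∉⊥; ∣⊥∣≡0)
open import Data.List
  using (List; []; _∷_; [_]; _++_; length; map; mapMaybe; filter; filterᵇ; foldr; applyUpTo; lookup; tabulate; allFin; reverse)
open import Data.List.Membership.Propositional using (_∈_; _∉_; find)
open import Data.List.Membership.Propositional.Properties
  using ( ∈-lookup; ∈-map⁺; ∈-map⁻; ∈-++⁺ˡ; ∈-++⁺ʳ; ∈-filter⁺; ∈-filter⁻
        ; ∈-allFin; ∈-tabulate⁺; ∈-tabulate⁻)
import Data.List.Membership.DecPropositional as DecMembership
open import Data.List.Properties using (length-map; length-tabulate)
open import Data.List.Relation.Binary.Subset.Propositional using (_⊆_)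
open import Data.List.Relation.Unary.All as All using (All; []; _∷_; all?)
import Data.List.Relation.Unary.All.Properties as Allₚ
open import Data.List.Relation.Unary.All.Properties.Core using (¬All⇒Any¬)
open import Data.List.Relation.Unary.AllPairs using ([]; _∷_)
open import Data.List.Relation.Unary.Any as Any using (here; there)
open import Data.List.Relation.Unary.Any.Properties using (any⁻; lookup-index)
open import Data.List.Relation.Unary.Unique.Propositional using (Unique)
import Data.List.Relation.Unary.Unique.Propositional.Properties as Uniqueₚ
open import Data.Maybe using (Maybe; just; nothing; maybe)
import Data.Maybe as Maybe
open import Data.Nat using (ℕ; zero; suc; _≤_; _<_; _+_; _∸_; _⊔_; _<ᵇ_; _≡ᵇ_; z≤n; s≤s)
open import Data.Nat.Properties
  using ( ≤-refl; ≤-trans; ≤-reflexive; ≤-pred; <⇒≱; ≮⇒≥; m≤n⇒m≤1+n; <ᵇ⇒<; ≡ᵇ⇒≡; ≡⇒≡ᵇ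
        ; +-comm; +-assoc; +-suc; +-mono-≤; +-monoˡ-≤; +-monoʳ-≤; +-cancelʳ-≤; m+n≤o⇒m≤o∸n; m≤n+o⇒m∸n≤o
        ; module ≤-Reasoning)
open import Data.Product using (∃-syntax; _×_; _,_; proj₁; proj₂; uncurry)
open import Data.Sum using (_⊎_; inj₁; inj₂; [_,_]′)
import Data.Sum as Sum
open import Data.Vec using (_∷_) renaming (here to vhere; there to vthere)
open import Function using (_∘_; Equivalence)
open import Function.Definitions using (Injective)
open import Relation.Nullary using (¬_; Dec; yes; no)
open import Relation.Nullary.Decidable using (T?; _×-dec_)
open import Relation.Binary.PropositionalEquality
  using (_≡_; _≢_; refl; sym; trans; cong; cong₂; subst; module ≡-Reasoning)

-- Equality through the builtin natural numbers, which the search evaluates fast.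
infix 7 _==_
_==_ : ∀ {m} → Fin m → Fin m → Bool
x == y = toℕ x ≡ᵇ toℕ y

==⇒≡ : ∀ {m} {x y : Fin m} → T (x == y) → x ≡ y
==⇒≡ {x = x} {y} t = toℕ-injective (≡ᵇ⇒≡ (toℕ x) (toℕ y) t)

count : ∀ {A : Set} → (A → Bool) → List A → ℕ
count f []       = 0
count f (x ∷ xs) = if f x then suc (count f xs) else count f xs

count≤length : ∀ {A : Set} (f : A → Bool) xs → count f xs ≤ length xs
count≤length f [] = z≤n
count≤length f (x ∷ xs) with f x
... | true  = s≤s (count≤length f xs)
... | false = m≤n⇒m≤1+n (count≤length f xs)

count≤count-∷ : ∀ {A : Set} (f : A → Bool) x xs → count f xs ≤ count f (x ∷ xs)
count≤count-∷ f x xs with f x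
... | true  = m≤n⇒m≤1+n ≤-refl
... | false = ≤-refl

count-mono : ∀ {A : Set} {f g : A → Bool} xs → (∀ x → T (f x) → T (g x)) → count f xs ≤ count g xs
count-mono [] f⇒g = z≤n
count-mono {f = f} {g} (x ∷ xs) f⇒g with f x | g x | f⇒g x
... | true  | true  | _   = s≤s (count-mono xs f⇒g)
... | true  | false | fx⇒ = ⊥-elim (fx⇒ _)
... | false | true  | _   = m≤n⇒m≤1+n (count-mono xs f⇒g)
... | false | false | _   = count-mono xs f⇒g

count+count-not≡length : ∀ {A : Set} (f : A → Bool) xs → count f xs + count (not ∘ f) xs ≡ length xs
count+count-not≡length f [] = refl
count+count-not≡length f (x ∷ xs) with f x
... | true  = cong suc (count+count-not≡length f xs)
... | false = trans (+-suc (count f xs) _) (cong suc (count+count-not≡length f xs))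

count-map : ∀ {A B : Set} (f : B → Bool) (h : A → B) xs → count f (map h xs) ≡ count (f ∘ h) xs
count-map f h [] = refl
count-map f h (x ∷ xs) with f (h x)
... | true  = cong suc (count-map f h xs)
... | false = count-map f h xs

count-++ : ∀ {A : Set} (f : A → Bool) xs ys → count f (xs ++ ys) ≡ count f xs + count f ys
count-++ f [] ys = refl
count-++ f (x ∷ xs) ys with f x
... | true  = cong suc (count-++ f xs ys)
... | false = count-++ f xs ys

count-none : ∀ {A : Set} (f : A → Bool) xs → (∀ x → T (not (f x))) → count f xs ≡ 0
count-none f [] none = refl
count-none f (x ∷ xs) none with f x | none x
... | false | _ = count-none f xs none

∈⇒1≤count : ∀ {A : Set} (f : A → Bool) {x xs} → x ∈ xs → T (f x) → 1 ≤ count f xs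
∈⇒1≤count f {xs = y ∷ ys} (here refl) t rewrite Equivalence.to T-≡ t = s≤s z≤n
∈⇒1≤count f {xs = y ∷ ys} (there x∈) t = ≤-trans (∈⇒1≤count f x∈ t) (count≤count-∷ f y ys)

length≤count⇒All : ∀ {A : Set} (f : A → Bool) xs → length xs ≤ count f xs → All (T ∘ f) xs
length≤count⇒All f [] _ = []
length≤count⇒All f (x ∷ xs) full with f x in fx | count≤length f xs
... | true  | _   = Equivalence.from T-≡ fx ∷ length≤count⇒All f xs (≤-pred full)
... | false | ≤xs = ⊥-elim (<⇒≱ full ≤xs)

count≡length-filter : ∀ {A : Set} (f : A → Bool) xs → count f xs ≡ length (filterᵇ f xs)
count≡length-filter f [] = refl
count≡length-filter f (x ∷ xs) with f x
... | true  = cong suc (count≡length-filter f xs)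
... | false = count≡length-filter f xs

countColour : ∀ {A : Set} → (A → Bool) → (A → Fin 3) → Fin 3 → List A → ℕ
countColour e κ k = count (λ x → e x ∧ (κ x == k))

countColours≤length : ∀ {A : Set} (e : A → Bool) (κ : A → Fin 3) xs
                    → countColour e κ (# 0) xs + countColour e κ (# 1) xs + countColour e κ (# 2) xs ≤ length xs
countColours≤length e κ [] = z≤n
countColours≤length e κ (x ∷ xs) with e x | κ x | countColours≤length e κ xs
... | false | _              | ih = m≤n⇒m≤1+n ih
... | true  | zero           | ih = s≤s ih
... | true  | suc zero       | ih = subst (_≤ suc (length xs)) (sym (cong (_+ c₂) (+-suc c₀ c₁))) (s≤s ih)
  where
  c₀ = countColour e κ (# 0) xs
  c₁ = countColour e κ (# 1) xs
  c₂ = countColour e κ (# 2) xs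
... | true  | suc (suc zero) | ih = subst (_≤ suc (length xs)) (sym (+-suc (c₀ + c₁) c₂)) (s≤s ih)
  where
  c₀ = countColour e κ (# 0) xs
  c₁ = countColour e κ (# 1) xs
  c₂ = countColour e κ (# 2) xs

+≡⇒≤∸ : ∀ {a b n lo} → a + b ≡ n → lo ≤ a → b ≤ n ∸ lo
+≡⇒≤∸ {a} {b} sum lo≤a = m+n≤o⇒m≤o∸n b (≤-trans (+-monoʳ-≤ b lo≤a) (≤-reflexive (trans (+-comm b a) sum)))

+≡⇒∸≤ : ∀ {a b n d} → a + b ≡ n → a ≤ d → n ∸ d ≤ b
+≡⇒∸≤ {a} {b} {n} {d} sum a≤d = m≤n+o⇒m∸n≤o n d (subst (_≤ d + b) sum (+-monoˡ-≤ b a≤d))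

first≤ : ∀ {a b c s t} → a + b + c ≤ s + t + t → t ≤ b → t ≤ c → a ≤ s
first≤ {a} {b} {c} {s} {t} sum t≤b t≤c = +-cancelʳ-≤ (t + t) a s (begin
  a + (t + t)  ≤⟨ +-monoʳ-≤ a (+-mono-≤ t≤b t≤c) ⟩
  a + (b + c)  ≡⟨ sym (+-assoc a b c) ⟩
  a + b + c    ≤⟨ sum ⟩
  s + t + t    ≡⟨ +-assoc s t t ⟩
  s + (t + t)  ∎)
  where open ≤-Reasoning

each≤ : ∀ {a b c s t} → a + b + c ≤ s + t + t → t ≤ a → t ≤ b → t ≤ c → a ≤ s × b ≤ s × c ≤ s
each≤ {a} {b} {c} {s} {t} sum t≤a t≤b t≤c =
    first≤ sum t≤b t≤c
  , first≤ (subst (_≤ s + t + t) (cong (_+ c) (+-comm a b)) sum) t≤a t≤c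
  , first≤ (subst (_≤ s + t + t) (trans (+-comm (a + b) c) (sym (+-assoc c a b))) sum) t≤a t≤b

select₃ : ∀ {ℓ} {P : Fin 3 → Set ℓ} k → P (# 0) × P (# 1) × P (# 2) → P k
select₃ zero             = proj₁
select₃ (suc zero)       = proj₁ ∘ proj₂
select₃ (suc (suc zero)) = proj₂ ∘ proj₂

lookup-injective : ∀ {A : Set} {xs : List A} → Unique xs → Injective _≡_ _≡_ (lookup xs)
lookup-injective {xs = x ∷ xs} (x∉ ∷ u) {zero}  {zero}  _ = refl
lookup-injective {xs = x ∷ xs} (x∉ ∷ u) {zero}  {suc j} e = ⊥-elim (All.lookup x∉ (∈-lookup j) e)
lookup-injective {xs = x ∷ xs} (x∉ ∷ u) {suc i} {zero}  e = ⊥-elim (All.lookup x∉ (∈-lookup i) (sym e))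
lookup-injective {xs = x ∷ xs} (x∉ ∷ u) {suc i} {suc j} e = cong suc (lookup-injective u e)

unique-⊆⇒length≤ : ∀ {A : Set} {xs ys : List A} → Unique xs → xs ⊆ ys → length xs ≤ length ys
unique-⊆⇒length≤ {xs = xs} {ys} u xs⊆ys = injective⇒≤ position-injective
  where
  position : Fin (length xs) → Fin (length ys)
  position i = Any.index (xs⊆ys (∈-lookup i))
  position-injective : Injective _≡_ _≡_ position
  position-injective {i} {j} e = lookup-injective u (begin
    lookup xs i             ≡⟨ lookup-index (xs⊆ys (∈-lookup i)) ⟩
    lookup ys (position i)  ≡⟨ cong (lookup ys) e ⟩
    lookup ys (position j)  ≡⟨ sym (lookup-index (xs⊆ys (∈-lookup j))) ⟩
    lookup xs j             ∎)
    where open ≡-Reasoning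

count-mono-⊆ : ∀ {A : Set} (f : A → Bool) {xs ys : List A}
             → Unique xs → (∀ {x} → x ∈ xs → T (f x) → x ∈ ys) → count f xs ≤ count f ys
count-mono-⊆ f {xs} {ys} u xs⊆ys = begin
  count f xs             ≡⟨ count≡length-filter f xs ⟩
  length (filterᵇ f xs)  ≤⟨ unique-⊆⇒length≤ (Uniqueₚ.filter⁺ (T? ∘ f) u) filtered⊆ ⟩
  length (filterᵇ f ys)  ≡⟨ sym (count≡length-filter f ys) ⟩
  count f ys             ∎
  where
  open ≤-Reasoning
  filtered⊆ : filterᵇ f xs ⊆ filterᵇ f ys
  filtered⊆ x∈ = let x∈xs , fx = ∈-filter⁻ (T? ∘ f) {xs = xs} x∈ in ∈-filter⁺ (T? ∘ f) (xs⊆ys x∈xs fx) fx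

module _ {m : ℕ} where
  open DecMembership (_≟_ {m}) using (_∈?_; _∉?_)

  unique-⊆-length⇒⊇ : {xs ys : List (Fin m)} → Unique xs → xs ⊆ ys → length ys ≤ length xs → ys ⊆ xs
  unique-⊆-length⇒⊇ {xs} {ys} u xs⊆ys ys≤xs {y} y∈ys with y ∈? xs
  ... | yes y∈xs = y∈xs
  ... | no  y∉xs = ⊥-elim (<⇒≱ (unique-⊆⇒length≤ (fresh ∷ u) y∷xs⊆ys) ys≤xs)
    where
    fresh : All (y ≢_) xs
    fresh = All.tabulate λ z∈ y≡z → y∉xs (subst (_∈ xs) (sym y≡z) z∈)
    y∷xs⊆ys : (y ∷ xs) ⊆ ys
    y∷xs⊆ys (here refl) = y∈ys
    y∷xs⊆ys (there z∈)  = xs⊆ys z∈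

  longer⇒∃∉ : {xs ys : List (Fin m)} → Unique xs → length ys < length xs → ∃[ x ] x ∈ xs × x ∉ ys
  longer⇒∃∉ {xs} {ys} u shorter with all? (_∈? ys) xs
  ... | yes xs⊆ys  = ⊥-elim (<⇒≱ shorter (unique-⊆⇒length≤ u (All.lookup xs⊆ys)))
  ... | no  ¬xs⊆ys = find (¬All⇒Any¬ (_∈? ys) xs ¬xs⊆ys)

  length<count⇒∃∉ : (f : Fin m → Bool) {xs : List (Fin m)} → Unique xs
                  → ∀ ys → length ys < count f xs → ∃[ x ] T (f x) × x ∉ ys
  length<count⇒∃∉ f {xs} u ys shorter
    with longer⇒∃∉ (Uniqueₚ.filter⁺ (T? ∘ f) u) (≤-trans shorter (≤-reflexive (count≡length-filter f xs)))
  ... | x , x∈ , x∉ = x , proj₂ (∈-filter⁻ (T? ∘ f) {xs = xs} x∈) , x∉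

  extendToCovering : (xs : List (Fin m)) → Unique xs → ∃[ zs ] Unique (xs ++ zs) × m ≤ length (xs ++ zs)
  extendToCovering xs u = zs , Uniqueₚ.++⁺ u (Uniqueₚ.filter⁺ (_∉? xs) (Uniqueₚ.allFin⁺ m)) disjoint , covers
    where
    zs = filter (_∉? xs) (allFin m)
    disjoint : ∀ {x} → x ∈ xs × x ∈ zs → ⊥
    disjoint (x∈xs , x∈zs) = proj₂ (∈-filter⁻ (_∉? xs) {xs = allFin m} x∈zs) x∈xs
    allFin⊆ : allFin m ⊆ xs ++ zs
    allFin⊆ {x} _ with x ∈? xs
    ... | yes x∈xs = ∈-++⁺ˡ x∈xs
    ... | no  x∉xs = ∈-++⁺ʳ xs (∈-filter⁺ (_∉? xs) {xs = allFin m} (∈-allFin x) x∉xs)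
    covers : m ≤ length (xs ++ zs)
    covers = subst (_≤ length (xs ++ zs)) (length-tabulate _) (unique-⊆⇒length≤ (Uniqueₚ.allFin⁺ m) allFin⊆)

enumerate : ∀ {A : Set} {r} (ys : List A) → r ≤ length ys → Fin r → A
enumerate ys r≤ i = lookup ys (inject≤ i r≤)

enumerate-injective : ∀ {A : Set} {r} {ys : List A} (r≤ : r ≤ length ys)
                    → Unique ys → Injective _≡_ _≡_ (enumerate ys r≤)
enumerate-injective r≤ u e = inject≤-injective r≤ r≤ _ _ (lookup-injective u e)

enumerate-∈ : ∀ {A : Set} {r} (ys : List A) (r≤ : r ≤ length ys) i → enumerate ys r≤ i ∈ ys
enumerate-∈ ys r≤ i = ∈-lookup (inject≤ i r≤)

record Witnesses {A : Set} (r : ℕ) (f : A → Bool) (xs : List A) : Set where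
  field
    witness   : Fin r → A
    injective : Injective _≡_ _≡_ witness
    satisfies : ∀ i → T (f (witness i))
    member    : ∀ i → witness i ∈ xs

witnesses : ∀ {A : Set} {r} (f : A → Bool) {xs : List A} → Unique xs → r ≤ count f xs → Witnesses r f xs
witnesses f {xs} u r≤ = record
  { witness   = enumerate ys r≤′
  ; injective = enumerate-injective r≤′ (Uniqueₚ.filter⁺ (T? ∘ f) u)
  ; satisfies = λ i → All.lookup (Allₚ.all-filter (T? ∘ f) xs) (enumerate-∈ ys r≤′ i)
  ; member    = λ i → proj₁ (∈-filter⁻ (T? ∘ f) {xs = xs} (enumerate-∈ ys r≤′ i))
  }
  where
  ys = filterᵇ f xs
  r≤′ = ≤-trans r≤ (≤-reflexive (count≡length-filter f xs))

BoolGraph : ℕ → Set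
BoolGraph m = Fin m → Fin m → Bool

Symmetric : ∀ {m} → BoolGraph m → Set
Symmetric g = ∀ x y → g x y ≡ g y x

Irreflexive : ∀ {m} → BoolGraph m → Set
Irreflexive g = ∀ x → g x x ≡ false

adjacent⇒≢ : ∀ {m} {g : BoolGraph m} → Irreflexive g → ∀ {x y} → T (g x y) → x ≢ y
adjacent⇒≢ irr {x} t refl rewrite irr x = t

pairsOf : ∀ {A : Set} → List A → List (A × A)
pairsOf []       = []
pairsOf (x ∷ xs) = map (x ,_) xs ++ pairsOf xs

∈-pairsOf : ∀ {A : Set} {x y : A} {xs} → x ∈ xs → y ∈ xs → x ≢ y → (x , y) ∈ pairsOf xs ⊎ (y , x) ∈ pairsOf xs
∈-pairsOf (here refl) (here refl) x≢y = ⊥-elim (x≢y refl)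
∈-pairsOf (here refl) (there y∈)  _   = inj₁ (∈-++⁺ˡ (∈-map⁺ _ y∈))
∈-pairsOf (there x∈)  (here refl) _   = inj₂ (∈-++⁺ˡ (∈-map⁺ _ x∈))
∈-pairsOf {xs = z ∷ zs} (there x∈) (there y∈) x≢y = Sum.map (∈-++⁺ʳ _) (∈-++⁺ʳ _) (∈-pairsOf x∈ y∈ x≢y)

edgesAmong : ∀ {m} → BoolGraph m → List (Fin m) → ℕ
edgesAmong g xs = count (uncurry g) (pairsOf xs)

edgesAmong-∷ : ∀ {m} (g : BoolGraph m) x xs → edgesAmong g (x ∷ xs) ≡ count (g x) xs + edgesAmong g xs
edgesAmong-∷ g x xs =
  trans (count-++ (uncurry g) (map (x ,_) xs) (pairsOf xs)) (cong (_+ edgesAmong g xs) (count-map (uncurry g) (x ,_) xs))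

edge⇒1≤edgesAmong : ∀ {m} {g : BoolGraph m} → Symmetric g
                  → ∀ {x y xs} → x ∈ xs → y ∈ xs → x ≢ y → T (g x y) → 1 ≤ edgesAmong g xs
edge⇒1≤edgesAmong {g = g} sym-g {x} {y} x∈ y∈ x≢y t with ∈-pairsOf x∈ y∈ x≢y
... | inj₁ xy∈ = ∈⇒1≤count (uncurry g) xy∈ t
... | inj₂ yx∈ = ∈⇒1≤count (uncurry g) yx∈ (subst T (sym-g x y) t)

SpanAtLeast : ∀ {m} → ℕ → ℕ → BoolGraph m → Set
SpanAtLeast k lo g = ∀ xs → Unique xs → length xs ≡ k → lo ≤ edgesAmong g xs

SpanAtMost : ∀ {m} → ℕ → ℕ → BoolGraph m → Set
SpanAtMost k hi g = ∀ xs → Unique xs → length xs ≡ k → edgesAmong g xs ≤ hi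

MaxDegree : ∀ {m} → ℕ → BoolGraph m → Set
MaxDegree d g = ∀ v xs → Unique xs → count (g v) xs ≤ d

MaxNonDegree : ∀ {m} → ℕ → BoolGraph m → Set
MaxNonDegree d g = ∀ v xs → Unique (v ∷ xs) → count (not ∘ g v) xs ≤ d

Triangle : ∀ {m} → BoolGraph m → Fin m → Fin m → Fin m → Set
Triangle g a b c = T (g a b) × T (g a c) × T (g b c)

triangleFree⇒spanAtMost : ∀ {m} {g : BoolGraph m} → (∀ a b c → ¬ Triangle g a b c) → SpanAtMost 3 2 g
triangleFree⇒spanAtMost {g = g} noTriangle (a ∷ b ∷ c ∷ []) _ refl =
  ≮⇒≥ (triangle ∘ length≤count⇒All (uncurry g) (pairsOf (a ∷ b ∷ c ∷ [])))
  where
  triangle : All (T ∘ uncurry g) (pairsOf (a ∷ b ∷ c ∷ [])) → ⊥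
  triangle (ab ∷ ac ∷ bc ∷ []) = noTriangle a b c (ab , ac , bc)

others : ∀ {m} → Fin (suc m) → List (Fin (suc m))
others v = tabulate (punchIn v)

others-∌ : ∀ {m} (v : Fin (suc m)) → All (v ≢_) (others v)
others-∌ v = All.tabulate λ w∈ v≡w → let j , w≡ = ∈-tabulate⁻ w∈ in punchInᵢ≢i v j (sym (trans v≡w w≡))

others-unique : ∀ {m} (v : Fin (suc m)) → Unique (others v)
others-unique v = Uniqueₚ.tabulate⁺ (punchIn-injective v _ _)

∷others-unique : ∀ {m} (v : Fin (suc m)) → Unique (v ∷ others v)
∷others-unique v = others-∌ v ∷ others-unique v

length-others : ∀ {m} (v : Fin (suc m)) → length (others v) ≡ m
length-others v = length-tabulate _

∈-others : ∀ {m} {v x : Fin (suc m)} → x ≢ v → x ∈ others v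
∈-others {v = v} x≢v = subst (_∈ others v) (punchIn-punchOut (x≢v ∘ sym)) (∈-tabulate⁺ (punchOut (x≢v ∘ sym)))

relabel : ∀ {k m} → (Fin k → Fin m) → BoolGraph m → BoolGraph k
relabel L g i j = g (L i) (L j)

edgesAmong-relabel : ∀ {k m} (L : Fin k → Fin m) g xs → edgesAmong (relabel L g) xs ≡ edgesAmong g (map L xs)
edgesAmong-relabel L g [] = refl
edgesAmong-relabel L g (x ∷ xs) = begin
  edgesAmong (relabel L g) (x ∷ xs)                     ≡⟨ edgesAmong-∷ (relabel L g) x xs ⟩
  count (g (L x) ∘ L) xs + edgesAmong (relabel L g) xs  ≡⟨ cong₂ _+_ (sym (count-map (g (L x)) L xs))
                                                                    (edgesAmong-relabel L g xs) ⟩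
  count (g (L x)) (map L xs) + edgesAmong g (map L xs)  ≡⟨ sym (edgesAmong-∷ g (L x) (map L xs)) ⟩
  edgesAmong g (map L (x ∷ xs))                         ∎
  where open ≡-Reasoning

module _ {k m} {L : Fin k → Fin m} (L-injective : Injective _≡_ _≡_ L) {g : BoolGraph m} where

  private
    unique-map : ∀ {xs} → Unique xs → Unique (map L xs)
    unique-map = Uniqueₚ.map⁺ L-injective

  relabel-symmetric : Symmetric g → Symmetric (relabel L g)
  relabel-symmetric sym-g i j = sym-g (L i) (L j)

  relabel-spanAtLeast : ∀ {j lo} → SpanAtLeast j lo g → SpanAtLeast j lo (relabel L g)
  relabel-spanAtLeast {lo = lo} span xs u len =
    subst (lo ≤_) (sym (edgesAmong-relabel L g xs)) (span (map L xs) (unique-map u) (trans (length-map L xs) len))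

  relabel-spanAtMost : ∀ {j hi} → SpanAtMost j hi g → SpanAtMost j hi (relabel L g)
  relabel-spanAtMost {hi = hi} span xs u len =
    subst (_≤ hi) (sym (edgesAmong-relabel L g xs)) (span (map L xs) (unique-map u) (trans (length-map L xs) len))

  relabel-maxDegree : ∀ {d} → MaxDegree d g → MaxDegree d (relabel L g)
  relabel-maxDegree {d} maxDeg v xs u = subst (_≤ d) (count-map (g (L v)) L xs) (maxDeg (L v) (map L xs) (unique-map u))

  relabel-maxNonDegree : ∀ {d} → MaxNonDegree d g → MaxNonDegree d (relabel L g)
  relabel-maxNonDegree {d} maxNonDeg v xs u =
    subst (_≤ d) (count-map (not ∘ g (L v)) L xs) (maxNonDeg (L v) (map L xs) (unique-map u))

  nonNeighbours-spanAtLeast : ∀ {j lo} → SpanAtLeast (suc j) lo g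
                            → ∀ v → (∀ i → L i ≢ v) → (∀ i → T (not (g v (L i))))
                            → SpanAtLeast j lo (relabel L g)
  nonNeighbours-spanAtLeast {lo = lo} span v L≢v nonAdjacent xs u len = begin
    lo                                                ≤⟨ span (v ∷ map L xs) (v∉ ∷ unique-map u)
                                                                (cong suc (trans (length-map L xs) len)) ⟩
    edgesAmong g (v ∷ map L xs)                       ≡⟨ edgesAmong-∷ g v (map L xs) ⟩
    count (g v) (map L xs) + edgesAmong g (map L xs)  ≡⟨ cong₂ _+_ (trans (count-map (g v) L xs)
                                                                          (count-none (g v ∘ L) xs nonAdjacent))
                                                                   (sym (edgesAmong-relabel L g xs)) ⟩
    edgesAmong (relabel L g) xs                       ∎
    where
    open ≤-Reasoning
    v∉ : All (v ≢_) (map L xs)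
    v∉ = Allₚ.map⁺ (All.universal (λ i → L≢v i ∘ sym) xs)

-- Backtracking search over cardinality clauses

record Clause : Set where
  constructor atMost
  field
    vars     : List ℕ
    maxTrue  : ℕ
    maxFalse : ℕ

Holds : (ℕ → Bool) → Clause → Set
Holds v (atMost xs t f) = count v xs ≤ t × count (not ∘ v) xs ≤ f

_!?_ : ∀ {A : Set} → List A → ℕ → Maybe A
[]       !? _     = nothing
(x ∷ xs) !? zero  = just x
(x ∷ xs) !? suc i = xs !? i

assigned : Bool → Maybe Bool → Bool
assigned b = maybe (λ c → if b then c else not c) false

violated : List Bool → Clause → Bool
violated ρ (atMost xs t f) =
  (t <ᵇ count (assigned true ∘ (ρ !?_)) xs) ∨ (f <ᵇ count (assigned false ∘ (ρ !?_)) xs)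

-- ρ assigns the variables 0 … length ρ - 1; after variable k is assigned, the
-- clauses of level k are checked against the partial assignment.
mutual
  refutes : List (List Clause) → List Bool → Bool
  refutes []         ρ = false
  refutes (cs ∷ css) ρ = refutesAfter cs css (ρ ++ [ false ]) ∧ refutesAfter cs css (ρ ++ [ true ])

  refutesAfter : List Clause → List (List Clause) → List Bool → Bool
  refutesAfter cs css ρ = any (violated ρ) cs ∨ refutes css ρ

Agrees : (ℕ → Bool) → List Bool → Set
Agrees v ρ = ∀ x b → ρ !? x ≡ just b → v x ≡ b

agrees-snoc : ∀ v ρ → Agrees v ρ → Agrees v (ρ ++ [ v (length ρ) ])
agrees-snoc v []      _  zero    b refl = refl
agrees-snoc v []      _  (suc x) b ()
agrees-snoc v (c ∷ ρ) ag zero    b e    = ag zero b e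
agrees-snoc v (c ∷ ρ) ag (suc x) b e    = agrees-snoc (v ∘ suc) ρ (ag ∘ suc) x b e

assigned-agrees : ∀ {v} ρ → Agrees v ρ → ∀ b x → T (assigned b (ρ !? x)) → T (assigned b (just (v x)))
assigned-agrees ρ ag b x t with ρ !? x in e
... | just c rewrite ag x c e = t

-- A clause only bounds the numbers of true and of false variables, so once a
-- partial assignment violates it, so does every total one extending it.
violated-sound : ∀ {v} ρ c → Agrees v ρ → Holds v c → T (violated ρ c) → ⊥
violated-sound ρ (atMost xs t f) ag (t-bound , f-bound) viol with Equivalence.to T-∨ viol
... | inj₁ t< = <⇒≱ (<ᵇ⇒< t _ t<) (≤-trans (count-mono xs (assigned-agrees ρ ag true)) t-bound)
... | inj₂ f< = <⇒≱ (<ᵇ⇒< f _ f<) (≤-trans (count-mono xs (assigned-agrees ρ ag false)) f-bound)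

refutes-sound : ∀ v css ρ → All (All (Holds v)) css → Agrees v ρ → T (refutes css ρ) → ⊥
refutes-sound v (cs ∷ css) ρ (hs ∷ hss) ag r = after (chosen (v (length ρ)) (Equivalence.to T-∧ r))
  where
  ρ′ = ρ ++ [ v (length ρ) ]
  chosen : ∀ b → T (refutesAfter cs css (ρ ++ [ false ])) × T (refutesAfter cs css (ρ ++ [ true ]))
         → T (refutesAfter cs css (ρ ++ [ b ]))
  chosen false = proj₁
  chosen true  = proj₂
  after : T (refutesAfter cs css ρ′) → ⊥
  after t with Equivalence.to T-∨ t
  ... | inj₂ rest = refutes-sound v css ρ′ hss (agrees-snoc v ρ ag) rest
  ... | inj₁ viol = violated-sound ρ′ (Any.lookup witness) (agrees-snoc v ρ ag) holds violates
    where
    witness  = any⁻ (violated ρ′) cs viol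
    holds    = proj₁ (All.lookupAny hs witness)
    violates = proj₂ (All.lookupAny hs witness)

Pair : ℕ → Set
Pair m = Fin m × Fin m

samePair : ∀ {m} → Pair m → Pair m → Bool
samePair (x , y) (u , v) = (x == u ∧ y == v) ∨ (x == v ∧ y == u)

samePair-sound : ∀ {m} {g : BoolGraph m} → Symmetric g → ∀ p q → T (samePair p q) → uncurry g p ≡ uncurry g q
samePair-sound {g = g} sym-g (x , y) (u , v) t = [ same , swapped ]′ (Equivalence.to T-∨ t)
  where
  same : T (x == u ∧ y == v) → g x y ≡ g u v
  same t′ = let x=u , y=v = Equivalence.to T-∧ t′ in cong₂ g (==⇒≡ x=u) (==⇒≡ y=v)
  swapped : T (x == v ∧ y == u) → g x y ≡ g u v
  swapped t′ = let x=v , y=u = Equivalence.to T-∧ t′ in trans (cong₂ g (==⇒≡ x=v) (==⇒≡ y=u)) (sym-g v u)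

record Constraint (m : ℕ) : Set where
  constructor edgeBounds
  field
    pairs       : List (Pair m)
    maxEdges    : ℕ
    maxNonEdges : ℕ

Satisfies : ∀ {m} → BoolGraph m → Constraint m → Set
Satisfies g (edgeBounds ps t f) = count (uncurry g) ps ≤ t × count (not ∘ uncurry g) ps ≤ f

indexOf : ∀ {m} → List (Pair m) → Pair m → Maybe ℕ
indexOf []       p = nothing
indexOf (q ∷ qs) p = if samePair q p then just 0 else Maybe.map suc (indexOf qs p)

valuation : ∀ {m} → BoolGraph m → List (Pair m) → ℕ → Bool
valuation g order x = maybe (uncurry g) false (order !? x)

valuation-indexOf : ∀ {m} {g : BoolGraph m} → Symmetric g
                  → ∀ order p x → indexOf order p ≡ just x → valuation g order x ≡ uncurry g p
valuation-indexOf sym-g (q ∷ qs) p x e with samePair q p in same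
... | true  with refl ← e = samePair-sound sym-g q p (Equivalence.from T-≡ same)
... | false with indexOf qs p in e′
...   | just y  with refl ← e = valuation-indexOf sym-g qs p y e′
...   | nothing with () ← e

count-mapMaybe : ∀ {A : Set} {v : ℕ → Bool} {w : A → Bool} (idx : A → Maybe ℕ) (φ : Bool → Bool)
               → (∀ a x → idx a ≡ just x → v x ≡ w a)
               → ∀ as → count (φ ∘ v) (mapMaybe idx as) ≤ count (φ ∘ w) as
count-mapMaybe idx φ agree [] = z≤n
count-mapMaybe {w = w} idx φ agree (a ∷ as) with idx a in e
... | nothing = ≤-trans (count-mapMaybe idx φ agree as) (count≤count-∷ (φ ∘ w) a as)
... | just x rewrite agree a x e with φ (w a)
...   | true  = s≤s (count-mapMaybe idx φ agree as)
...   | false = count-mapMaybe idx φ agree as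

-- Pairs missing from the order are dropped, which only weakens the clause.
compile : ∀ {m} → List (Pair m) → Constraint m → Clause
compile order (edgeBounds ps t f) = atMost (mapMaybe (indexOf order) ps) t f

compile-sound : ∀ {m} {g : BoolGraph m} → Symmetric g
              → ∀ order c → Satisfies g c → Holds (valuation g order) (compile order c)
compile-sound sym-g order (edgeBounds ps t f) (t-bound , f-bound) =
    ≤-trans (count-mapMaybe (indexOf order) (λ b → b) (valuation-indexOf sym-g order) ps) t-bound
  , ≤-trans (count-mapMaybe (indexOf order) not (valuation-indexOf sym-g order) ps) f-bound

-- Each clause is checked once, at the level of its last variable; the levels
-- affect only the speed of the search, not its soundness.
levels : ℕ → List Clause → List (List Clause)
levels n cs = applyUpTo (λ k → filterᵇ (λ c → foldr _⊔_ 0 (Clause.vars c) ≡ᵇ k) cs) n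

search : ∀ {m} → List (Pair m) → List (Constraint m) → Bool
search order cs = refutes (levels (length order) (map (compile order) cs)) []

-- Stated with `≡ true` so that a certificate is the proof `refl`: checking
-- `tt : T (search order cs)` instead is several times slower.
search-sound : ∀ {m} (g : BoolGraph m) → Symmetric g → ∀ order cs → All (Satisfies g) cs → search order cs ≡ true → ⊥
search-sound g sym-g order cs sat found =
  refutes-sound (valuation g order) _ [] (Allₚ.applyUpTo⁺₂ _ (length order) (λ _ → Allₚ.filter⁺ _ holds)) (λ _ _ ())
    (Equivalence.from T-≡ found)
  where
  holds : All (Holds (valuation g order)) (map (compile order) cs)
  holds = Allₚ.map⁺ (All.map (λ {c} → compile-sound sym-g order c) sat)

subsets : ∀ {A : Set} → ℕ → List A → List (List A)
subsets zero    xs       = [] ∷ []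
subsets (suc k) []       = []
subsets (suc k) (x ∷ xs) = map (x ∷_) (subsets k xs) ++ subsets (suc k) xs

subsets-sound : ∀ {A : Set} k {xs : List A} → Unique xs
              → All (λ ys → ys ⊆ xs × Unique ys × length ys ≡ k) (subsets k xs)
subsets-sound zero                u          = ((λ ()) , [] , refl) ∷ []
subsets-sound (suc k) {[]}       u          = []
subsets-sound (suc k) {x ∷ xs} (x∉xs ∷ u) =
  Allₚ.++⁺ (Allₚ.map⁺ (All.map withHead (subsets-sound k u)))
           (All.map (λ (ys⊆xs , uys , len) → (λ {y} y∈ → there (ys⊆xs y∈)) , uys , len) (subsets-sound (suc k) u))
  where
  withHead : ∀ {ys} → ys ⊆ xs × Unique ys × length ys ≡ k
           → (x ∷ ys) ⊆ (x ∷ xs) × Unique (x ∷ ys) × length (x ∷ ys) ≡ suc k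
  withHead (ys⊆xs , uys , len) =
      (λ { (here e) → here e ; (there y∈) → there (ys⊆xs y∈) })
    , Allₚ.anti-mono ys⊆xs x∉xs ∷ uys
    , cong suc len

onSubsets : ∀ {m} → ℕ → (List (Fin m) → Constraint m) → List (Constraint m)
onSubsets k c = map c (subsets k (allFin _))

onSubsets-satisfied : ∀ {m} k {c : List (Fin m) → Constraint m} {g : BoolGraph m}
                    → (∀ xs → Unique xs → length xs ≡ k → Satisfies g (c xs)) → All (Satisfies g) (onSubsets k c)
onSubsets-satisfied {m} k sat =
  Allₚ.map⁺ (All.map (λ (_ , uxs , len) → sat _ uxs len) (subsets-sound k (Uniqueₚ.allFin⁺ m)))

atLeastEdges : ∀ {m} → ℕ → List (Fin m) → Constraint m
atLeastEdges lo xs = edgeBounds (pairsOf xs) (length (pairsOf xs)) (length (pairsOf xs) ∸ lo)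

atMostEdges : ∀ {m} → ℕ → List (Fin m) → Constraint m
atMostEdges hi xs = edgeBounds (pairsOf xs) hi (length (pairsOf xs))

spanAtLeast-satisfied : ∀ {m k lo} {g : BoolGraph m} → SpanAtLeast k lo g → All (Satisfies g) (onSubsets k (atLeastEdges lo))
spanAtLeast-satisfied {k = k} {g = g} span = onSubsets-satisfied k λ xs uxs len →
  count≤length (uncurry g) (pairsOf xs) , +≡⇒≤∸ (count+count-not≡length (uncurry g) (pairsOf xs)) (span xs uxs len)

spanAtMost-satisfied : ∀ {m k hi} {g : BoolGraph m} → SpanAtMost k hi g → All (Satisfies g) (onSubsets k (atMostEdges hi))
spanAtMost-satisfied {k = k} {g = g} span = onSubsets-satisfied k λ xs uxs len →
  span xs uxs len , count≤length (not ∘ uncurry g) (pairsOf xs)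

degreeBounds : ∀ {m} → ℕ → ℕ → List (Constraint (suc m))
degreeBounds d e = map (λ v → edgeBounds (map (v ,_) (others v)) d e) (allFin _)

degreeBounds-satisfied : ∀ {m d e} {g : BoolGraph (suc m)} → MaxDegree d g → MaxNonDegree e g
                       → All (Satisfies g) (degreeBounds d e)
degreeBounds-satisfied {d = d} {e} {g} maxDeg maxNonDeg = Allₚ.map⁺ (All.universal row _)
  where
  row : ∀ v → Satisfies g (edgeBounds (map (v ,_) (others v)) d e)
  row v = subst (_≤ d) (sym (count-map (uncurry g) (v ,_) (others v))) (maxDeg v (others v) (others-unique v))
        , subst (_≤ e) (sym (count-map (not ∘ uncurry g) (v ,_) (others v))) (maxNonDeg v (others v) (∷others-unique v))

isEdge : ∀ {m} → Fin m → Fin m → Constraint m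
isEdge x y = edgeBounds [ (x , y) ] 1 0

isEdge-satisfied : ∀ {m} (g : BoolGraph m) {x y} → T (g x y) → Satisfies g (isEdge x y)
isEdge-satisfied g t rewrite Equivalence.to T-≡ t = s≤s z≤n , z≤n

columnOrder : ∀ m → List (Pair m)
columnOrder m = reverse (pairsOf (allFin m))

-- Three finite facts, decided by running the search during type checking

ramsey33 : (g : BoolGraph 6) → Symmetric g → SpanAtLeast 3 1 g → SpanAtMost 3 2 g → ⊥
ramsey33 g sym-g span≥ span≤ = search-sound g sym-g (columnOrder 6)
  (onSubsets 3 (atLeastEdges 1) ++ onSubsets 3 (atMostEdges 2))
  (Allₚ.++⁺ (spanAtLeast-satisfied span≥) (spanAtMost-satisfied span≤)) refl

sevenVertices-impossible : (g : BoolGraph 7) → Symmetric g → SpanAtLeast 3 1 g → SpanAtMost 4 4 g → ⊥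
sevenVertices-impossible g sym-g span≥ span≤ = search-sound g sym-g (columnOrder 7)
  (onSubsets 3 (atLeastEdges 1) ++ onSubsets 4 (atMostEdges 4))
  (Allₚ.++⁺ (spanAtLeast-satisfied span≥) (spanAtMost-satisfied span≤)) refl

-- The prescribed edges (a triangle 0 1 2, a third neighbour 3 of 0 and 4 of 1)
-- break the symmetry; they cut the search down to a few thousand nodes.
cubicWithTriangle-impossible : (g : BoolGraph 10) → Symmetric g → SpanAtLeast 4 1 g → SpanAtMost 4 4 g
                             → MaxDegree 3 g → MaxNonDegree 6 g
                             → T (g (# 0) (# 1)) → T (g (# 0) (# 2)) → T (g (# 1) (# 2))
                             → T (g (# 0) (# 3)) → T (g (# 1) (# 4)) → ⊥
cubicWithTriangle-impossible g sym-g span≥ span≤ maxDeg maxNonDeg e01 e02 e12 e03 e14 =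
  search-sound g sym-g (pairsOf (allFin 10))
    (isEdge (# 0) (# 1) ∷ isEdge (# 0) (# 2) ∷ isEdge (# 1) (# 2) ∷ isEdge (# 0) (# 3) ∷ isEdge (# 1) (# 4)
      ∷ degreeBounds 3 6 ++ onSubsets 4 (atLeastEdges 1) ++ onSubsets 4 (atMostEdges 4))
    (isEdge-satisfied g e01 ∷ isEdge-satisfied g e02 ∷ isEdge-satisfied g e12 ∷ isEdge-satisfied g e03 ∷ isEdge-satisfied g e14
      ∷ Allₚ.++⁺ (degreeBounds-satisfied maxDeg maxNonDeg)
                 (Allₚ.++⁺ (spanAtLeast-satisfied span≥) (spanAtMost-satisfied span≤)))
    refl

-- Graphs in which any four vertices span one to four edges

spanBounds⇒maxNonDegree6 : ∀ {m} {g : BoolGraph m} → Symmetric g → SpanAtLeast 4 1 g → SpanAtMost 4 4 g → MaxNonDegree 6 g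
spanBounds⇒maxNonDegree6 {g = g} sym-g span≥ span≤ v xs (v∉xs ∷ u) = ≮⇒≥ sevenNonNeighbours
  where
  sevenNonNeighbours : 6 < count (not ∘ g v) xs → ⊥
  sevenNonNeighbours 7≤ = sevenVertices-impossible (relabel witness g) (relabel-symmetric injective sym-g)
    (nonNeighbours-spanAtLeast injective span≥ v (λ i → All.lookup v∉xs (member i) ∘ sym) satisfies)
    (relabel-spanAtMost injective span≤)
    where open Witnesses (witnesses (not ∘ g v) u 7≤)

neighbours+nonNeighbours : ∀ (g : BoolGraph 10) v → count (g v) (others v) + count (not ∘ g v) (others v) ≡ 9
neighbours+nonNeighbours g v = trans (count+count-not≡length (g v) (others v)) (length-others v)

degree≥3 : ∀ {g : BoolGraph 10} → MaxNonDegree 6 g → ∀ v → 3 ≤ count (g v) (others v)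
degree≥3 {g} maxNonDeg v = +≡⇒∸≤ {n = 9}
  (trans (+-comm (count (not ∘ g v) (others v)) _) (neighbours+nonNeighbours g v)) (maxNonDeg v (others v) (∷others-unique v))

-- Case analyses on values computed from the abstract graph g use `let` or
-- auxiliary functions instead of `with`: with-abstraction normalises such
-- values, e.g. a `filter` over the vertices, to exponentially large terms.
module ThreeRegular {g : BoolGraph 10} (sym-g : Symmetric g) (irr : Irreflexive g)
                    (span≥ : SpanAtLeast 4 1 g) (span≤ : SpanAtMost 4 4 g) (maxDeg : MaxDegree 3 g) where

  maxNonDeg : MaxNonDegree 6 g
  maxNonDeg = spanBounds⇒maxNonDegree6 sym-g span≥ span≤

  nonDegree≥6 : ∀ v → 6 ≤ count (not ∘ g v) (others v)
  nonDegree≥6 v = +≡⇒∸≤ {n = 9} (neighbours+nonNeighbours g v) (maxDeg v (others v) (others-unique v))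

  neighbourAvoiding : ∀ u p q → ∃[ n ] T (g u n) × n ∉ p ∷ q ∷ []
  neighbourAvoiding u p q = length<count⇒∃∉ (g u) (others-unique u) (p ∷ q ∷ []) (degree≥3 maxNonDeg u)

  fourVerticesFiveEdges : ∀ {a b c n} → Unique (a ∷ b ∷ c ∷ n ∷ [])
                        → T (g a b) → T (g a c) → T (g a n) → T (g b c) → T (g b n) → ⊥
  fourVerticesFiveEdges {a} {b} {c} {n} u ab ac an bc bn = tooMany (span≤ (a ∷ b ∷ c ∷ n ∷ []) u refl)
    where
    tooMany : edgesAmong g (a ∷ b ∷ c ∷ n ∷ []) ≤ 4 → ⊥
    tooMany rewrite Equivalence.to T-≡ ab | Equivalence.to T-≡ ac | Equivalence.to T-≡ an
                  | Equivalence.to T-≡ bc | Equivalence.to T-≡ bn = λ { (s≤s (s≤s (s≤s (s≤s ())))) }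

  fiveVertices : ∀ {a b c n m} → Unique (a ∷ b ∷ c ∷ n ∷ m ∷ [])
               → T (g a b) → T (g a c) → T (g b c) → T (g a n) → T (g b m) → ⊥
  fiveVertices {a} {b} {c} {n} {m} u ab ac bc an bm =
    uncurry (λ zs (u′ , covers) → enumerated zs u′ covers) (extendToCovering (a ∷ b ∷ c ∷ n ∷ m ∷ []) u)
    where
    -- L sends 0, …, 4 to a, b, c, n, m by computation, so ab … bm fit the prescribed edges.
    enumerated : ∀ zs → Unique (a ∷ b ∷ c ∷ n ∷ m ∷ zs) → 10 ≤ length (a ∷ b ∷ c ∷ n ∷ m ∷ zs) → ⊥
    enumerated zs u′ covers = cubicWithTriangle-impossible (relabel L g) (relabel-symmetric L-injective sym-g)
        (relabel-spanAtLeast L-injective span≥) (relabel-spanAtMost L-injective span≤)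
        (relabel-maxDegree L-injective maxDeg) (relabel-maxNonDegree L-injective maxNonDeg)
        ab ac bc an bm
      where
      L = enumerate (a ∷ b ∷ c ∷ n ∷ m ∷ zs) covers
      L-injective = enumerate-injective covers u′

  thirdNeighbours : ∀ {a b c n m} → Triangle g a b c
                  → T (g a n) → n ∉ b ∷ c ∷ [] → T (g b m) → m ∉ a ∷ c ∷ [] → ⊥
  thirdNeighbours {a} {b} {c} {n} {m} (ab , ac , bc) an n∉bc bm m∉ac = fiveVertices distinct ab ac bc an bm
    where
    a≢m : a ≢ m
    a≢m e = m∉ac (here (sym e))
    b≢n : b ≢ n
    b≢n e = n∉bc (here (sym e))
    c≢n : c ≢ n
    c≢n e = n∉bc (there (here (sym e)))
    c≢m : c ≢ m
    c≢m e = m∉ac (there (here (sym e)))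
    n≢m : n ≢ m
    n≢m refl = fourVerticesFiveEdges
      ((adjacent⇒≢ irr ab ∷ adjacent⇒≢ irr ac ∷ adjacent⇒≢ irr an ∷ [])
        ∷ (adjacent⇒≢ irr bc ∷ b≢n ∷ []) ∷ (c≢n ∷ []) ∷ [] ∷ [])
      ab ac an bc bm
    distinct : Unique (a ∷ b ∷ c ∷ n ∷ m ∷ [])
    distinct = (adjacent⇒≢ irr ab ∷ adjacent⇒≢ irr ac ∷ adjacent⇒≢ irr an ∷ a≢m ∷ [])
             ∷ (adjacent⇒≢ irr bc ∷ b≢n ∷ adjacent⇒≢ irr bm ∷ [])
             ∷ (c≢n ∷ c≢m ∷ []) ∷ (n≢m ∷ []) ∷ [] ∷ []

  withTriangle : ∀ {a b c} → Triangle g a b c → ⊥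
  withTriangle {a} {b} {c} triangle =
    let n , an , n∉bc = neighbourAvoiding a b c
        m , bm , m∉ac = neighbourAvoiding b a c
    in  thirdNeighbours triangle an n∉bc bm m∉ac

  triangleFree : (∀ a b c → ¬ Triangle g a b c) → ⊥
  triangleFree noTriangle = ramsey33 (relabel witness g) (relabel-symmetric injective sym-g)
    (nonNeighbours-spanAtLeast injective span≥ zero (λ i → All.lookup (others-∌ zero) (member i) ∘ sym) satisfies)
    (triangleFree⇒spanAtMost (λ a b c → noTriangle (witness a) (witness b) (witness c)))
    where open Witnesses (witnesses (not ∘ g zero) (others-unique zero) (nonDegree≥6 zero))

  impossible : ⊥
  impossible = decide (any? λ a → any? λ b → any? λ c → T? (g a b) ×-dec T? (g a c) ×-dec T? (g b c))
    where
    decide : Dec (∃[ a ] ∃[ b ] ∃[ c ] Triangle g a b c) → ⊥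
    decide (yes (_ , _ , _ , triangle)) = withTriangle triangle
    decide (no  noTriangle)             = triangleFree λ a b c t → noTriangle (a , b , c , t)

-- Rainbow trees

toSubset : ∀ {n} → List (Fin n) → Subset n
toSubset = foldr (λ x p → ⁅ x ⁆ ∪ p) ∅

∈-toSubset⁺ : ∀ {n} {x : Fin n} {xs} → x ∈ xs → x ∈ₛ toSubset xs
∈-toSubset⁺ {x = x} (here refl) = x∈p∪q⁺ (inj₁ (x∈⁅x⁆ x))
∈-toSubset⁺ (there x∈)          = x∈p∪q⁺ (inj₂ (∈-toSubset⁺ x∈))

∈-toSubset⁻ : ∀ {n} {x : Fin n} xs → x ∈ₛ toSubset xs → x ∈ xs
∈-toSubset⁻ []       x∈ = ⊥-elim (∉⊥ x∈)
∈-toSubset⁻ (y ∷ ys) x∈ with x∈p∪q⁻ ⁅ y ⁆ (toSubset ys) x∈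
... | inj₁ x∈y  = here (x∈⁅y⁆⇒x≡y y x∈y)
... | inj₂ x∈ys = there (∈-toSubset⁻ ys x∈ys)

∣⁅x⁆∪p∣ : ∀ {n} (x : Fin n) (p : Subset n) → x ∉ₛ p → ∣ ⁅ x ⁆ ∪ p ∣ ≡ suc ∣ p ∣
∣⁅x⁆∪p∣ zero    (outside ∷ p) _   = cong (suc ∘ ∣_∣) (∪-identityˡ p)
∣⁅x⁆∪p∣ zero    (inside ∷ p)  x∉p = ⊥-elim (x∉p vhere)
∣⁅x⁆∪p∣ (suc x) (outside ∷ p) x∉p = ∣⁅x⁆∪p∣ x p (x∉p ∘ vthere)
∣⁅x⁆∪p∣ (suc x) (inside ∷ p)  x∉p = cong suc (∣⁅x⁆∪p∣ x p (x∉p ∘ vthere))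

∣toSubset∣ : ∀ {n} {xs : List (Fin n)} → Unique xs → ∣ toSubset xs ∣ ≡ length xs
∣toSubset∣ {n} {[]}     []         = ∣⊥∣≡0 n
∣toSubset∣ {xs = x ∷ xs} (x∉xs ∷ u) =
  trans (∣⁅x⁆∪p∣ x (toSubset xs) (λ x∈ → All.lookup x∉xs (∈-toSubset⁻ xs x∈) refl))
        (cong suc (∣toSubset∣ u))

module RainbowTrees {n} (G : Graph n) (col : EdgeColoring G 3) (rainbow : Is4Rainbow G col) where

  colour : Fin n → Fin n → Fin 3
  colour = proj₁ col

  -- The rainbow tree through xs has at most three edges, hence at most four
  -- vertices: exactly those of xs, joined by three edges of distinct colours.
  everyColourSpanned : ∀ xs → Unique xs → length xs ≡ 4 → ∀ k
                     → ∃[ x ] ∃[ y ] x ∈ xs × y ∈ xs × Adj G x y × colour x y ≡ k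
  everyColourSpanned xs u len k = x , y , verts⊆xs x∈ , verts⊆xs y∈ , All.lookup edgesInG e∈ , sym k≡
    where
    tree = rainbow (toSubset xs) (trans (∣toSubset∣ u) len)
    open TreeIn (proj₁ tree)
    colours = map (λ e → colour (proj₁ e) (proj₂ e)) edges
    distinctColours : Unique colours
    distinctColours = proj₂ tree
    xs⊆verts : xs ⊆ verts
    xs⊆verts x∈ = containsS _ (∈-toSubset⁺ x∈)
    edges≤3 : length edges ≤ 3
    edges≤3 = subst (_≤ 3) (length-map _ edges) (unique-⊆⇒length≤ distinctColours (λ {c} _ → ∈-allFin c))
    verts⊆xs : verts ⊆ xs
    verts⊆xs = unique-⊆-length⇒⊇ u xs⊆verts (subst (length verts ≤_) (sym len) (subst (_≤ 4) size (s≤s edges≤3)))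
    3≤colours : 3 ≤ length colours
    3≤colours = subst (3 ≤_) (sym (length-map _ edges))
      (≤-pred (subst (4 ≤_) (sym size) (subst (_≤ length verts) len (unique-⊆⇒length≤ u xs⊆verts))))
    k∈colours : k ∈ colours
    k∈colours = unique-⊆-length⇒⊇ distinctColours (λ {c} _ → ∈-allFin c) 3≤colours (∈-allFin k)
    found = ∈-map⁻ (λ e → colour (proj₁ e) (proj₂ e)) k∈colours
    x = proj₁ (proj₁ found)
    y = proj₂ (proj₁ found)
    e∈ = proj₁ (proj₂ found)
    k≡ = proj₂ (proj₂ found)
    x∈ = proj₁ (All.lookup endpoints e∈)
    y∈ = proj₂ (All.lookup endpoints e∈)

module ColourClasses {n} (G : Graph n) (col : EdgeColoring G 3) (rainbow : Is4Rainbow G col)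
                     (ι : Fin 10 → Fin n) (ι-injective : Injective _≡_ _≡_ ι) where
  open RainbowTrees G col rainbow
  open Graph G using (adj)

  class : Fin 3 → BoolGraph 10
  class k x y = adj (ι x) (ι y) ∧ (colour (ι x) (ι y) == k)

  class-symmetric : ∀ k → Symmetric (class k)
  class-symmetric k x y rewrite Graph.sym G (ι x) (ι y) with adj (ι y) (ι x) in yx
  ... | false = refl
  ... | true  = cong (_== k) (proj₂ col (ι x) (ι y) (trans (Graph.sym G (ι x) (ι y)) yx))

  class-irreflexive : ∀ k → Irreflexive (class k)
  class-irreflexive k x rewrite Graph.irrefl G (ι x) = refl

  class-spanAtLeast : ∀ k → SpanAtLeast 4 1 (class k)
  class-spanAtLeast k xs u len with everyColourSpanned (map ι xs) (Uniqueₚ.map⁺ ι-injective u) (trans (length-map ι xs) len) k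
  ... | _ , _ , x′∈ , y′∈ , xy-adjacent , xy-coloured with ∈-map⁻ ι x′∈ | ∈-map⁻ ι y′∈
  ...   | x , x∈ , refl | y , y∈ , refl =
    edge⇒1≤edgesAmong (class-symmetric k) x∈ y∈ (adjacent⇒≢ (class-irreflexive k) xy-class) xy-class
    where
    xy-class : T (class k x y)
    xy-class rewrite xy-adjacent | xy-coloured = ≡⇒≡ᵇ (toℕ k) _ refl

  class-spanAtMost : ∀ k → SpanAtMost 4 4 (class k)
  class-spanAtMost k xs@(_ ∷ _ ∷ _ ∷ _ ∷ []) u refl = select₃ {P = λ k → edgesAmong (class k) xs ≤ 4} k
    (each≤ (countColours≤length (λ p → adj (ι (proj₁ p)) (ι (proj₂ p)))
                                (λ p → colour (ι (proj₁ p)) (ι (proj₂ p))) (pairsOf xs))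
           (class-spanAtLeast (# 0) xs u refl) (class-spanAtLeast (# 1) xs u refl) (class-spanAtLeast (# 2) xs u refl))

  class-maxNonDegree : ∀ k → MaxNonDegree 6 (class k)
  class-maxNonDegree k = spanBounds⇒maxNonDegree6 (class-symmetric k) (class-spanAtLeast k) (class-spanAtMost k)

  class-maxDegree : ∀ k → MaxDegree 3 (class k)
  class-maxDegree k v xs u = ≤-trans
    (count-mono-⊆ (class k v) u (λ _ vx → ∈-others (adjacent⇒≢ (class-irreflexive k) vx ∘ sym)))
    (select₃ {P = λ k → count (class k v) (others v) ≤ 3} k
      (each≤ (countColours≤length (adj (ι v) ∘ ι) (colour (ι v) ∘ ι) (others v))
             (degree≥3 (class-maxNonDegree (# 0)) v)
             (degree≥3 (class-maxNonDegree (# 1)) v)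
             (degree≥3 (class-maxNonDegree (# 2)) v)))

  impossible : ⊥
  impossible = ThreeRegular.impossible (class-symmetric (# 0)) (class-irreflexive (# 0))
    (class-spanAtLeast (# 0)) (class-spanAtMost (# 0)) (class-maxDegree (# 0))

proposition2p3 : (n : ℕ) (G : Graph n) → Connected G → rx4≡ G 3 → n ≤ 9
proposition2p3 n G _ ((col , rainbow) , _) = ≮⇒≥ λ 9<n →
  ColourClasses.impossible G col rainbow (λ i → inject≤ i 9<n) (inject≤-injective 9<n 9<n _ _)
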